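{- Let $\mathcal{F}$ be any transitive frame and $n\ge 0$. 1. $\mathcal{F}\models\mathbb{C}_n$ iff $\mathcal{F}$ has circumference at most $n$ and has no strictly ascending chains. 2. If $\mathcal{F}$ is finite, then $\mathcal{F}\models\mathbb{C}_n$ iff $\mathcal{F}$ has circumference at most $n$.
   Context: Modal formulas are built from propositional variables by $\top,\neg,\wedge,\Box$, with $\Diamond=\neg\Box\neg$, $\Box^*\varphi=\varphi\wedge\Box\varphi$. A frame $(W,R)$ is a set with a binary relation; a model on it adds a valuation of variables, with standard Kripke truth ($\Box\varphi$ true at $x$ iff $\varphi$ true at all $R$-successors of $x$). A formula is valid in a frame if true at every point of every model on it; a scheme is valid if all its instances are. An $n$-cycle ($n\ge1$) is a sequence of $n$ distinct points $x_0,\dots,x_{n-1}$ with $x_0Rx_1R\cdots Rx_{n-1}Rx_0$. The circumference of a frame is the supremum of lengths of its cycles (0 if there are none). An ascending chain is a sequence $(x_m)_{m<\omega}$ with $x_mRx_{m+1}$ for all $m$; it is strictly ascending if never $x_{m+1}Rx_m$. Define $\mathbb{P}_0(\varphi_0)=\Diamond\varphi_0$ and for $n>0$, $\mathbb{P}_n(\varphi_0,\dots,\varphi_n)=\Diamond(\varphi_1\wedge\mathbb{P}_{n-1}(\varphi_0,\varphi_2,\dots,\varphi_n))$. Let $\mathbb{D}_n(\varphi_0,\dots,\varphi_n)=\bigwedge_{i<j\le n}\neg(\varphi_i\wedge\varphi_j)$ (which is $\top$ when $n=0$). $\mathbb{C}_n$ is the scheme $\Box^*\mathbb{D}_n(\varphi_0,\dots,\varphi_n)\to(\Diamond\varphi_0\to\Diamond(\varphi_0\wedge\neg\mathbb{P}_n(\varphi_0,\dots,\varphi_n)))$,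 i.e. all uniform substitution instances of this formula with distinct variables $p_0,\dots,p_n$ in place of the $\varphi_i$. -}

module Defs where

open import Level using (0ℓ)
open import Data.Nat using (ℕ; zero; suc; _≤_)
open import Data.Fin using (Fin; inject₁; fromℕ) renaming (zero to fzero; suc to fsuc)
open import Data.List using (List; []; _∷_; map; foldr; upTo)
open import Data.Unit using (⊤)
open import Data.Product using (Σ; _×_; ∃)
open import Relation.Nullary using (¬_)
open import Relation.Binary.PropositionalEquality using (_≡_)
open import Function.Definitions using (Injective)
open import Function.Bundles using (_↔_)

data Form : Set where
  var  : ℕ → Form
  ⊤'   : Form
  ¬'_  : Form → Form
  _∧'_ : Form → Form → Form
  □_   : Form → Form

infixr 6 _∧'_
infixr 4 _⇒'_

◇_ : Form → Form
◇ φ = ¬' (□ (¬' φ))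

_⇒'_ : Form → Form → Form
φ ⇒' ψ = ¬' (φ ∧' (¬' ψ))

□*_ : Form → Form
□* φ = φ ∧' (□ φ)

⋀ : List Form → Form
⋀ = foldr _∧'_ ⊤'

sub : (ℕ → Form) → Form → Form
sub σ (var i)  = σ i
sub σ ⊤'       = ⊤'
sub σ (¬' φ)   = ¬' (sub σ φ)
sub σ (φ ∧' ψ) = sub σ φ ∧' sub σ ψ
sub σ (□ φ)    = □ (sub σ φ)

-- ℙ φ₀ [φ₁ , … , φₙ] = ℙₙ(φ₀, φ₁, …, φₙ)
--   ℙ₀(φ₀) = ◇ φ₀
--   ℙₙ(φ₀,…,φₙ) = ◇(φ₁ ∧ ℙₙ₋₁(φ₀, φ₂, …, φₙ))
ℙ : Form → List Form → Form
ℙ φ₀ []         = ◇ φ₀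
ℙ φ₀ (φ₁ ∷ φs)  = ◇ (φ₁ ∧' ℙ φ₀ φs)

𝔻 : List Form → Form
𝔻 []       = ⊤'
𝔻 (φ ∷ φs) = ⋀ (map (λ ψ → ¬' (φ ∧' ψ)) φs) ∧' 𝔻 φs

restVars : ℕ → List Form
restVars n = map (λ i → var (suc i)) (upTo n)

ℂ : ℕ → Form
ℂ n = (□* 𝔻 (var 0 ∷ restVars n))
        ⇒' ((◇ var 0) ⇒' (◇ (var 0 ∧' ¬' ℙ (var 0) (restVars n))))

record Frame : Set₁ where
  field
    W : Set
    R : W → W → Set

open Frame public

Valuation : Frame → Set₁
Valuation F = ℕ → W F → Set

Sat : (F : Frame) → Valuation F → W F → Form → Set
Sat F V x (var i)  = V i x
Sat F V x ⊤'       = ⊤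
Sat F V x (¬' φ)   = ¬ Sat F V x φ
Sat F V x (φ ∧' ψ) = Sat F V x φ × Sat F V x ψ
Sat F V x (□ φ)    = ∀ y → R F x y → Sat F V y φ

Valid : Frame → Form → Set₁
Valid F φ = ∀ (V : Valuation F) (x : W F) → Sat F V x φ

ValidC : Frame → ℕ → Set₁
ValidC F n = ∀ (σ : ℕ → Form) → Valid F (sub σ (ℂ n))

Transitive : Frame → Set
Transitive F = ∀ {x y z} → R F x y → R F y z → R F x z

-- a cycle of length (suc k): distinct x₀,…,x_k with x₀Rx₁R…Rx_kRx₀
Cycle : (F : Frame) → ℕ → Set
Cycle F k =
  Σ (Fin (suc k) → W F) λ x →
    Injective _≡_ _≡_ x
    × (∀ (i : Fin k) → R F (x (inject₁ i)) (x (fsuc i)))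
    × R F (x (fromℕ k)) (x fzero)

CircumferenceAtMost : Frame → ℕ → Set
CircumferenceAtMost F n = ∀ k → Cycle F k → suc k ≤ n

StrictlyAscendingChain : Frame → Set
StrictlyAscendingChain F =
  Σ (ℕ → W F) λ c →
    (∀ m → R F (c m) (c (suc m))) × (∀ m → ¬ R F (c (suc m)) (c m))

NoStrictlyAscendingChain : Frame → Set
NoStrictlyAscendingChain F = ¬ StrictlyAscendingChain F

Finite : Frame → Set
Finite F = ∃ λ k → W F ↔ Fin k

-- ℂₙ fails in a transitive frame exactly when the frame carries an infinite walk w₀ R w₁ R ⋯
-- that revisits a point only after a multiple of n+1 steps.  Labelling wₘ by p_(m mod n+1)
-- makes 𝔻ₙ true everywhere and gives every p₀-point the path p₁,…,pₙ,p₀ demanded by ℙₙ, so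
-- ℂₙ fails at w₀; conversely, a failure of ℂₙ lets one follow the paths promised by ℙₙ
-- forever, and 𝔻ₙ turns the labels into residues that separate points.  A cycle of length
-- n+1 traversed repeatedly, or a strictly ascending chain, is such a walk.  Conversely, if
-- from some point on every step of the walk can be reversed, n+1 consecutive points from there
-- form a cycle of length n+1; otherwise the irreversible steps yield (classically) a strictly
-- ascending chain.  By transitivity the points of a cycle all see each other, so a longer cycle
-- contains one of length n+1; and a finite frame has no strictly ascending chain, as the points
-- of such a chain are pairwise distinct.

module Submission where

open import Defs
open import Level using (0ℓ)
open import Data.Nat using (ℕ; zero; suc; _+_; _*_; _≤_; _<_; z≤n; s≤s; _%_; _<?_; _≤?_; NonZero)
open import Data.Nat.Properties
open import Data.Nat.DivMod
  using (_mod_; m%n<n; m%n%n≡m%n; %-distribˡ-+; %-remove-+ʳ; [m+kn]%n≡m%n; m<n⇒m%n≡m; n%n≡0)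
open import Data.Nat.Divisibility using (m%n≡0⇒n∣m)
open import Data.List using (List; []; _∷_; map; drop; applyUpTo)
open import Data.List.Properties using (map-upTo; length-applyUpTo; drop-all)
open import Data.List.Relation.Unary.All using (All; []; _∷_)
import Data.List.Relation.Unary.All.Properties as All
open import Data.List.Relation.Unary.AllPairs using (AllPairs; []; _∷_)
import Data.List.Relation.Unary.AllPairs.Properties as AllPairs
open import Data.Unit using (tt)
open import Data.Fin using (Fin; toℕ; fromℕ; fromℕ<; inject₁; inject≤) renaming (zero to fzero; suc to fsuc)
open import Data.Fin.Properties
  using (toℕ-injective; toℕ-fromℕ; toℕ-fromℕ<; toℕ-inject₁; toℕ-inject≤; toℕ<n; inject≤-injective; pigeonhole)
open import Data.Fin.Induction using (>-weakInduction)
open import Data.Empty using (⊥-elim)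
open import Data.Sum using (_⊎_; inj₁; inj₂; [_,_]′)
open import Data.Product using (_×_; _,_; proj₁; proj₂; Σ; ∃)
open import Data.Product.Function.NonDependent.Propositional using (_×-⇔_)
open import Function using (_∘_; id)
open import Function.Bundles using (_⇔_; mk⇔; Equivalence; Injection)
open import Function.Properties.Inverse using (↔⇒↣)
open import Function.Definitions using (Injective)
import Function.Properties.Equivalence as ⇔
open import Relation.Binary.Core using (Rel)
open import Relation.Binary.Definitions using (tri<; tri≈; tri>)
open import Relation.Nullary using (¬_; yes; no)
open import Relation.Binary.PropositionalEquality
open import Axiom.ExcludedMiddle using (ExcludedMiddle)
open import Axiom.DoubleNegationElimination using (em⇒dne)

open Equivalence using (to; from)

private
  variable
    A : Set
    F : Frame
    n : ℕ

drop-applyUpTo : ∀ (f : ℕ → A) {j n} → j < n →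
                 drop j (applyUpTo f n) ≡ f j ∷ drop (suc j) (applyUpTo f n)
drop-applyUpTo f {zero}  {suc n} _         = refl
drop-applyUpTo f {suc j} {suc n} (s≤s j<n) = drop-applyUpTo (f ∘ suc) j<n

allPairs-applyUpTo⁻ : ∀ {R : Rel A 0ℓ} (f : ℕ → A) n → AllPairs R (applyUpTo f n) →
                      ∀ {i j} → i < j → j < n → R (f i) (f j)
allPairs-applyUpTo⁻ f (suc n) (px ∷ _) {zero} {suc j} _ (s≤s j<n) =
  All.applyUpTo⁻ (f ∘ suc) n px j<n
allPairs-applyUpTo⁻ f (suc n) (_ ∷ pxs) {suc i} {suc j} (s≤s i<j) (s≤s j<n) =
  allPairs-applyUpTo⁻ (f ∘ suc) n pxs i<j j<n

[1+m]%n≡[1+m%n]%n : ∀ m d .{{_ : NonZero d}} → suc m % d ≡ suc (m % d) % d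
[1+m]%n≡[1+m%n]%n m d = begin
  (1 + m) % d                ≡⟨ %-distribˡ-+ 1 m d ⟩
  (1 % d + m % d) % d        ≡⟨ cong (λ r → (1 % d + r) % d) (m%n%n≡m%n m d) ⟨
  (1 % d + m % d % d) % d    ≡⟨ %-distribˡ-+ 1 (m % d) d ⟨
  (1 + m % d) % d            ∎
  where open ≡-Reasoning

[1+m]%n≡1+m%n : ∀ m → m % suc n < n → suc m % suc n ≡ suc (m % suc n)
[1+m]%n≡1+m%n {n} m r<n = trans ([1+m]%n≡[1+m%n]%n m (suc n)) (m<n⇒m%n≡m (s≤s r<n))

[1+m]%n≡0 : ∀ m → m % suc n ≡ n → suc m % suc n ≡ 0
[1+m]%n≡0 {n} m r≡n = trans ([1+m]%n≡[1+m%n]%n m (suc n))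
  (trans (cong (λ r → suc r % suc n) r≡n) (n%n≡0 (suc n)))

sub-var : ∀ φ → sub var φ ≡ φ
sub-var (var i)  = refl
sub-var ⊤'       = refl
sub-var (¬' φ)   = cong ¬'_ (sub-var φ)
sub-var (φ ∧' ψ) = cong₂ _∧'_ (sub-var φ) (sub-var ψ)
sub-var (□ φ)    = cong □_ (sub-var φ)

Exclusive : (F : Frame) → Valuation F → ℕ → W F → Set
Exclusive F V n y = ∀ {i j} → i ≤ n → j ≤ n → V i y → V j y → i ≡ j

Walk : (F : Frame) → (ℕ → W F) → Set
Walk F w = ∀ m → R F (w m) (w (suc m))

ReversibleFrom : (F : Frame) → (ℕ → W F) → ℕ → Set
ReversibleFrom F w N = ∀ i → N ≤ i → R F (w (suc i)) (w i)

module _ {F : Frame} {V : Valuation F} where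

  sat-sub : ∀ σ φ {x} → Sat F V x (sub σ φ) ⇔ Sat F (λ i y → Sat F V y (σ i)) x φ
  sat-sub σ (var i)  = ⇔.refl
  sat-sub σ ⊤'       = ⇔.refl
  sat-sub σ (¬' φ)   = mk⇔ (λ ¬a → ¬a ∘ from (sat-sub σ φ)) (λ ¬b → ¬b ∘ to (sat-sub σ φ))
  sat-sub σ (φ ∧' ψ) = sat-sub σ φ ×-⇔ sat-sub σ ψ
  sat-sub σ (□ φ)    = mk⇔ (λ h y r → to (sat-sub σ φ) (h y r))
                           (λ h y r → from (sat-sub σ φ) (h y r))

  sat-⋀ : ∀ φs {x} → Sat F V x (⋀ φs) ⇔ All (Sat F V x) φs
  sat-⋀ []       = mk⇔ (λ _ → []) (λ _ → tt)
  sat-⋀ (φ ∷ φs) = mk⇔ (λ (a , as) → a ∷ to (sat-⋀ φs) as)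
                       λ { (a ∷ as) → a , from (sat-⋀ φs) as }

  sat-𝔻 : ∀ φs {x} → Sat F V x (𝔻 φs) ⇔ AllPairs (λ φ ψ → ¬ (Sat F V x φ × Sat F V x ψ)) φs
  sat-𝔻 []       = mk⇔ (λ _ → []) (λ _ → tt)
  sat-𝔻 (φ ∷ φs) = mk⇔
    (λ (h , t) → All.map⁻ (to (sat-⋀ (map _ φs)) h) ∷ to (sat-𝔻 φs) t)
    λ { (h ∷ t) → from (sat-⋀ (map _ φs)) (All.map⁺ h) , from (sat-𝔻 φs) t }

  sat-𝔻-vars : ∀ n {x} → Sat F V x (𝔻 (applyUpTo var (suc n))) ⇔ Exclusive F V n x
  sat-𝔻-vars n {x} = mk⇔ exclusive (λ e → from (sat-𝔻 _) (AllPairs.applyUpTo⁺₁ var (suc n)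
    λ i<j j<n (vi , vj) → <⇒≢ i<j (e (≤-pred (<-trans i<j j<n)) (≤-pred j<n) vi vj)))
    where
    exclusive : Sat F V x (𝔻 (applyUpTo var (suc n))) → Exclusive F V n x
    exclusive d {i} {j} i≤n j≤n vi vj
      with <-cmp i j | allPairs-applyUpTo⁻ var (suc n) (to (sat-𝔻 _) d)
    ... | tri< i<j _ _ | disjoint = ⊥-elim (disjoint i<j (s≤s j≤n) (vi , vj))
    ... | tri≈ _ i≡j _ | _        = i≡j
    ... | tri> _ _ j<i | disjoint = ⊥-elim (disjoint j<i (s≤s i≤n) (vj , vi))

  sat-ℙ-walk : ∀ m (φ : ℕ → Form) ψ {z : ℕ → W F} → Walk F z →
               (∀ {t} → t < m → Sat F V (z (suc t)) (φ t)) → Sat F V (z (suc m)) ψ →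
               Sat F V (z 0) (ℙ ψ (applyUpTo φ m))
  sat-ℙ-walk zero    φ ψ walk _  sψ □¬ψ = □¬ψ _ (walk 0) sψ
  sat-ℙ-walk (suc m) φ ψ walk sφ sψ □¬ = □¬ _ (walk 0)
    (sφ (s≤s z≤n) , sat-ℙ-walk m (φ ∘ suc) ψ (walk ∘ suc) (sφ ∘ s≤s) sψ)

  ◇-elim : ExcludedMiddle 0ℓ → ∀ {x} φ → Sat F V x (◇ φ) → ∃ λ y → R F x y × Sat F V y φ
  ◇-elim lem φ ◇φ = em⇒dne lem λ ∄y → ◇φ λ y r sφ → ∄y (y , r , sφ)

validInstances⇔valid : ∀ φ → (∀ σ → Valid F (sub σ φ)) ⇔ Valid F φ
validInstances⇔valid φ = mk⇔
  (λ v V x → subst (Sat _ V x) (sub-var φ) (v var V x))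
  (λ v σ V x → from (sat-sub {V = V} σ φ) (v _ x))

restVars≡applyUpTo : ∀ n → restVars n ≡ applyUpTo (var ∘ suc) n
restVars≡applyUpTo = map-upTo (var ∘ suc)

record Counterexample (F : Frame) (n : ℕ) (V : Valuation F) (x : W F) : Set where
  field
    exclusive   : Exclusive F V n x
    exclusive-□ : ∀ {y} → R F x y → Exclusive F V n y
    sees-p₀     : ∃ λ y → R F x y × V 0 y
    p₀⇒ℙ        : ∀ {y} → R F x y → V 0 y → Sat F V y (ℙ (var 0) (applyUpTo (var ∘ suc) n))

module _ {F : Frame} {V : Valuation F} {n : ℕ} {x : W F} where

  private
    𝔻-vars : ∀ {y} → Sat F V y (𝔻 (var 0 ∷ restVars n)) ⇔ Exclusive F V n y
    𝔻-vars {y} = subst (λ p₁⋯pₙ → Sat F V y (𝔻 (var 0 ∷ p₁⋯pₙ)) ⇔ Exclusive F V n y)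
                       (sym (restVars≡applyUpTo n)) (sat-𝔻-vars n)

    ℙ-vars : ∀ {y} → Sat F V y (ℙ (var 0) (applyUpTo (var ∘ suc) n))
                   ≡ Sat F V y (ℙ (var 0) (restVars n))
    ℙ-vars = cong (λ p₁⋯pₙ → Sat F V _ (ℙ (var 0) p₁⋯pₙ)) (sym (restVars≡applyUpTo n))

  counterexample⇒¬ℂ : Counterexample F n V x → ¬ Sat F V x (ℂ n)
  counterexample⇒¬ℂ ce satℂ =
    satℂ ( (from 𝔻-vars exclusive , λ _ r → from 𝔻-vars (exclusive-□ r))
         , λ k → k (◇p₀ , λ ◇bad → ◇bad λ _ r (v , ¬P) → ¬P (subst id ℙ-vars (p₀⇒ℙ r v))))
    where
    open Counterexample ce
    ◇p₀ : Sat F V x (◇ var 0)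
    ◇p₀ □¬p₀ = let (y , r , v) = sees-p₀ in □¬p₀ y r v

  ¬ℂ⇒counterexample : ExcludedMiddle 0ℓ → ¬ Sat F V x (ℂ n) → Counterexample F n V x
  ¬ℂ⇒counterexample lem ¬satℂ = record
    { exclusive   = to 𝔻-vars (proj₁ □*𝔻)
    ; exclusive-□ = λ r → to 𝔻-vars (proj₂ □*𝔻 _ r)
    ; sees-p₀     = ◇-elim {F = F} {V = V} lem (var 0) ◇p₀
    ; p₀⇒ℙ        = λ r v → subst id (sym ℙ-vars) (dne λ ¬P → dne ¬◇bad _ r (v , ¬P))
    }
    where
    dne = em⇒dne lem
    □*𝔻 : Sat F V x (□* 𝔻 (var 0 ∷ restVars n))
    □*𝔻 = proj₁ (dne ¬satℂ)
    ◇p₀ : Sat F V x (◇ var 0)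
    ◇p₀ = proj₁ (dne (proj₂ (dne ¬satℂ)))
    ¬◇bad : ¬ Sat F V x (◇ (var 0 ∧' ¬' ℙ (var 0) (restVars n)))
    ¬◇bad = proj₂ (dne (proj₂ (dne ¬satℂ)))

record ModWalk (F : Frame) (n : ℕ) : Set where
  field
    point   : ℕ → W F
    walk    : Walk F point
    revisit : ∀ {a b} → point a ≡ point b → a % suc n ≡ b % suc n

cycle⇒modWalk : Cycle F n → ModWalk F n
cycle⇒modWalk {F} {n} (x , injective , edge , close) = record
  { point = x ∘ (_mod suc n) ; walk = step ; revisit = λ {a} {b} → revisit a b }
  where
  toℕ-mod : ∀ m → toℕ (m mod suc n) ≡ m % suc n
  toℕ-mod m = toℕ-fromℕ< (m%n<n m (suc n))

  ≡mod : ∀ m {i} → toℕ i ≡ m % suc n → i ≡ m mod suc n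
  ≡mod m e = toℕ-injective (trans e (sym (toℕ-mod m)))

  step : Walk F (x ∘ (_mod suc n))
  step m with m % suc n <? n
  ... | yes r<n = subst₂ (λ i j → R F (x i) (x j))
          (≡mod m (trans (toℕ-inject₁ _) (toℕ-fromℕ< r<n)))
          (≡mod (suc m) (trans (cong suc (toℕ-fromℕ< r<n)) (sym ([1+m]%n≡1+m%n m r<n))))
          (edge (fromℕ< r<n))
  ... | no  r≮n = subst₂ (λ i j → R F (x i) (x j))
          (≡mod m (trans (toℕ-fromℕ n) (sym r≡n)))
          (≡mod (suc m) (sym ([1+m]%n≡0 m r≡n)))
          close
    where r≡n = ≤-antisym (≤-pred (m%n<n m (suc n))) (≮⇒≥ r≮n)

  revisit : ∀ a b → x (a mod suc n) ≡ x (b mod suc n) → a % suc n ≡ b % suc n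
  revisit a b eq = trans (sym (toℕ-mod a)) (trans (cong toℕ (injective eq)) (toℕ-mod b))

module _ {F : Frame} (tr : Transitive F) where

  walk-reaches : ∀ {w} → Walk F w → ∀ {i j} → i < j → R F (w i) (w j)
  walk-reaches {w} walk {i} {suc j} (s≤s i≤j) with m≤n⇒m<n∨m≡n i≤j
  ... | inj₁ i<j  = tr {y = w j} (walk-reaches walk i<j) (walk j)
  ... | inj₂ refl = walk i

  revisit⇒stepBack : ∀ {w} → Walk F w → ∀ {i j} → i < j → w i ≡ w j → R F (w (suc i)) (w i)
  revisit⇒stepBack {w} walk {i} (s≤s i≤j) wi≡wj with m≤n⇒m<n∨m≡n i≤j
  ... | inj₁ i<j  = subst (R F (w (suc i))) (sym wi≡wj) (walk-reaches walk (s≤s i<j))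
  ... | inj₂ refl = subst₂ (R F) wi≡wj (sym wi≡wj) (walk i)

  chain-injective : (ch : StrictlyAscendingChain F) → Injective _≡_ _≡_ (proj₁ ch)
  chain-injective (c , ascending , strict) {i} {j} ci≡cj with <-cmp i j
  ... | tri< i<j _ _ = ⊥-elim (strict i (revisit⇒stepBack {w = c} ascending i<j ci≡cj))
  ... | tri≈ _ i≡j _ = i≡j
  ... | tri> _ _ j<i = ⊥-elim (strict j (revisit⇒stepBack {w = c} ascending j<i (sym ci≡cj)))

  finite⇒noChain : Finite F → NoStrictlyAscendingChain F
  finite⇒noChain (k , W↔Fin) ch
    with pigeonhole (n<1+n k) (Injection.to (↔⇒↣ W↔Fin) ∘ proj₁ ch ∘ toℕ)
  ... | i , j , i<j , eq = <⇒≢ i<j (chain-injective ch (Injection.injective (↔⇒↣ W↔Fin) eq))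

  cycle-returns : ∀ {k} → ((x , _) : Cycle F k) → ∀ i → R F (x i) (x fzero)
  cycle-returns (x , _ , edge , close) =
    >-weakInduction (λ i → R F (x i) (x fzero)) close λ i r → tr {y = x (fsuc i)} (edge i) r

  cycle-shorten : ∀ {n k} → n ≤ k → Cycle F k → Cycle F n
  cycle-shorten {n} {k} n≤k cyc@(x , injective , edge , _) =
    x ∘ ι , inject≤-injective _ _ _ _ ∘ injective , edge′ , cycle-returns cyc (ι (fromℕ n))
    where
    ι : Fin (suc n) → Fin (suc k)
    ι i = inject≤ i (s≤s n≤k)

    ι-inject₁ : ∀ i → inject₁ (inject≤ i n≤k) ≡ ι (inject₁ i)
    ι-inject₁ i = toℕ-injective (begin
      toℕ (inject₁ (inject≤ i n≤k)) ≡⟨ toℕ-inject₁ _ ⟩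
      toℕ (inject≤ i n≤k)           ≡⟨ toℕ-inject≤ i n≤k ⟩
      toℕ i                         ≡⟨ toℕ-inject₁ i ⟨
      toℕ (inject₁ i)               ≡⟨ toℕ-inject≤ (inject₁ i) (s≤s n≤k) ⟨
      toℕ (ι (inject₁ i))           ∎)
      where open ≡-Reasoning

    edge′ : ∀ i → R F (x (ι (inject₁ i))) (x (ι (fsuc i)))
    edge′ i = subst (λ j → R F (x j) (x (fsuc (inject≤ i n≤k)))) (ι-inject₁ i) (edge (inject≤ i n≤k))

  circumference≤⇔¬cycle : ∀ {n} → CircumferenceAtMost F n ⇔ (¬ Cycle F n)
  circumference≤⇔¬cycle {n} = mk⇔ (λ circ cyc → 1+n≰n (circ n cyc)) at-most
    where
    at-most : ¬ Cycle F n → CircumferenceAtMost F n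
    at-most ¬cycle k cyc with suc k ≤? n
    ... | yes 1+k≤n = 1+k≤n
    ... | no  1+k≰n = ⊥-elim (¬cycle (cycle-shorten (≤-pred (≰⇒> 1+k≰n)) cyc))

  reversibleFrom-back : ∀ {w N} → ReversibleFrom F w N → ∀ {i j} → N ≤ i → i < j → R F (w j) (w i)
  reversibleFrom-back {w} rev {i} {suc j} N≤i (s≤s i≤j) with m≤n⇒m<n∨m≡n i≤j
  ... | inj₁ i<j  = tr {y = w j} (rev j (≤-trans N≤i i≤j)) (reversibleFrom-back rev N≤i i<j)
  ... | inj₂ refl = rev i N≤i

  irreversible⇒chain : ExcludedMiddle 0ℓ → ∀ {w} → Walk F w → (∀ N → ¬ ReversibleFrom F w N) →
                       StrictlyAscendingChain F
  irreversible⇒chain lem {w} walk ¬rev = c , ascending , strict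
    where
    dne = em⇒dne lem
    irreversibleAfter : ∀ N → ∃ λ i → N ≤ i × ¬ R F (w (suc i)) (w i)
    irreversibleAfter N = dne λ ∄i → ¬rev N λ i N≤i → dne λ ¬r → ∄i (i , N≤i , ¬r)

    nth : ℕ → ℕ
    nth zero    = proj₁ (irreversibleAfter 0)
    nth (suc k) = proj₁ (irreversibleAfter (suc (nth k)))

    nth-irreversible : ∀ k → ¬ R F (w (suc (nth k))) (w (nth k))
    nth-irreversible zero    = proj₂ (proj₂ (irreversibleAfter 0))
    nth-irreversible (suc k) = proj₂ (proj₂ (irreversibleAfter (suc (nth k))))

    nth-increasing : ∀ k → nth k < nth (suc k)
    nth-increasing k = proj₁ (proj₂ (irreversibleAfter (suc (nth k))))

    c : ℕ → W F
    c k = w (suc (nth k))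

    ascending : ∀ k → R F (c k) (c (suc k))
    ascending k = walk-reaches walk (s≤s (nth-increasing k))

    strict : ∀ k → ¬ R F (c (suc k)) (c k)
    strict k r with m≤n⇒m<n∨m≡n (nth-increasing k)
    ... | inj₁ lt = nth-irreversible (suc k) (tr {y = c k} r (walk-reaches walk lt))
    ... | inj₂ eq = nth-irreversible (suc k) (subst (R F (c (suc k)) ∘ w) eq r)

  reversible⇒cycle : ∀ {n N} (mw : ModWalk F n) → ReversibleFrom F (ModWalk.point mw) N → Cycle F n
  reversible⇒cycle {n} {N} mw rev = y , injective , edge , close
    where
    open ModWalk mw
    M = N * suc n
    N≤M = m≤m*n N (suc n)
    y : Fin (suc n) → W F
    y i = point (toℕ i + M)

    residue : ∀ i → (toℕ i + M) % suc n ≡ toℕ i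
    residue i = trans ([m+kn]%n≡m%n (toℕ i) N (suc n)) (m<n⇒m%n≡m (toℕ<n i))

    injective : Injective _≡_ _≡_ y
    injective {i} {j} yi≡yj = toℕ-injective (trans (sym (residue i)) (trans (revisit yi≡yj) (residue j)))

    edge : ∀ i → R F (y (inject₁ i)) (y (fsuc i))
    edge i = subst (λ t → R F (point (t + M)) (y (fsuc i))) (sym (toℕ-inject₁ i)) (walk (toℕ i + M))

    -- through point (suc (n + M)), so that a reflexive point (n = 0) is covered as well
    close : R F (y (fromℕ n)) (y fzero)
    close = subst (λ t → R F (point (t + M)) (point M)) (sym (toℕ-fromℕ n))
      (tr {y = point (suc (n + M))} (walk (n + M)) (reversibleFrom-back rev N≤M (s≤s (m≤n+m M n))))

  modWalk⇒cycle⊎chain : ExcludedMiddle 0ℓ → ∀ {n} → ModWalk F n → Cycle F n ⊎ StrictlyAscendingChain F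
  modWalk⇒cycle⊎chain lem mw with lem {∃ (ReversibleFrom F (ModWalk.point mw))}
  ... | yes (N , rev) = inj₁ (reversible⇒cycle mw rev)
  ... | no ¬rev       = inj₂ (irreversible⇒chain lem (ModWalk.walk mw) λ N rev → ¬rev (N , rev))

  chain⇒modWalk : ∀ {n} → StrictlyAscendingChain F → ModWalk F n
  chain⇒modWalk {n} ch@(c , ascending , _) = record
    { point = c ; walk = ascending ; revisit = cong (_% suc n) ∘ chain-injective ch }

  modWalk⇒¬validℂ : ∀ {n} → ModWalk F n → ¬ Valid F (ℂ n)
  modWalk⇒¬validℂ {n} mw valid = counterexample⇒¬ℂ counterexample (valid V (point 0))
    where
    open ModWalk mw
    V : Valuation F
    V i y = ∃ λ m → y ≡ point m × m % suc n ≡ i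

    exclusive : ∀ {y} → Exclusive F V n y
    exclusive _ _ (a , refl , refl) (b , eq , refl) = revisit eq

    shift : ∀ {m} → m % suc n ≡ 0 → ∀ t → (t + m) % suc n ≡ t % suc n
    shift {m} m%≡0 t = %-remove-+ʳ t (m%n≡0⇒n∣m m (suc n) m%≡0)

    p₀⇒ℙ : ∀ {y} → V 0 y → Sat F V y (ℙ (var 0) (applyUpTo (var ∘ suc) n))
    p₀⇒ℙ (m , refl , m%≡0) = sat-ℙ-walk n (var ∘ suc) (var 0) (λ t → walk (t + m))
      (λ {t} t<n → suc t + m , refl , trans (shift m%≡0 (suc t)) (m<n⇒m%n≡m (s≤s t<n)))
      (suc n + m , refl , trans (shift m%≡0 (suc n)) (n%n≡0 (suc n)))

    counterexample : Counterexample F n V (point 0)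
    counterexample = record
      { exclusive   = exclusive
      ; exclusive-□ = λ _ → exclusive
      ; sees-p₀     = point (suc n) , walk-reaches walk (s≤s z≤n) , suc n , refl , n%n≡0 (suc n)
      ; p₀⇒ℙ        = λ _ → p₀⇒ℙ
      }

  module _ (lem : ExcludedMiddle 0ℓ) {n : ℕ} {V : Valuation F} {x : W F}
           (ce : Counterexample F n V x) where

    open Counterexample ce

    private
      p₁⋯pₙ : List Form
      p₁⋯pₙ = applyUpTo (var ∘ suc) n

      record Visit (j : ℕ) : Set where
        field
          point    : W F
          seen     : R F x point
          labelled : V j point
          pending  : Sat F V point (ℙ (var 0) (drop j p₁⋯pₙ))
      open Visit

      Next : ∀ {j} → Visit j → ℕ → Set
      Next v j′ = Σ (Visit j′) λ v′ → R F (point v) (point v′)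

      visit-p₀ : ∀ {y} → R F x y → V 0 y → Visit 0
      visit-p₀ r v = record { point = _ ; seen = r ; labelled = v ; pending = p₀⇒ℙ r v }

      advance : ∀ {j} → j < n → (v : Visit j) → Next v (suc j)
      advance {j} j<n v =
        let (z , r , lab , pend) = ◇-elim {F = F} {V = V} lem
              (var (suc j) ∧' ℙ (var 0) (drop (suc j) p₁⋯pₙ))
              (subst (λ ps → Sat F V (point v) (ℙ (var 0) ps)) (drop-applyUpTo _ j<n) (pending v))
        in record { point = z ; seen = tr (seen v) r ; labelled = lab ; pending = pend } , r

      wrap : ∀ {j} → j ≡ n → (v : Visit j) → Next v 0
      wrap refl v =
        let (z , r , lab) = ◇-elim {F = F} {V = V} lem (var 0)
              (subst (λ ps → Sat F V (point v) (ℙ (var 0) ps))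
                     (drop-all n p₁⋯pₙ (≤-reflexive (length-applyUpTo _ n))) (pending v))
        in visit-p₀ (tr (seen v) r) lab , r

      step : ∀ m (v : Visit (m % suc n)) → Next v (suc m % suc n)
      step m v with m % suc n <? n
      ... | yes j<n = subst (Next v) (sym ([1+m]%n≡1+m%n m j<n)) (advance j<n v)
      ... | no  j≮n = subst (Next v) (sym ([1+m]%n≡0 m j≡n)) (wrap j≡n v)
        where j≡n = ≤-antisym (≤-pred (m%n<n m (suc n))) (≮⇒≥ j≮n)

      visit : ∀ m → Visit (m % suc n)
      visit zero    = let (_ , r , v) = sees-p₀ in visit-p₀ r v
      visit (suc m) = proj₁ (step m (visit m))

    counterexample⇒modWalk : ModWalk F n
    counterexample⇒modWalk = record
      { point   = point ∘ visit
      ; walk    = λ m → proj₂ (step m (visit m))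
      ; revisit = λ {a} {b} eq → exclusive-□ (seen (visit a)) (residue≤n a) (residue≤n b)
                                   (labelled (visit a)) (subst (V _) (sym eq) (labelled (visit b)))
      }
      where
      open Visit
      residue≤n : ∀ m → m % suc n ≤ n
      residue≤n m = ≤-pred (m%n<n m (suc n))

  ¬modWalk⇔¬cycle×noChain : ExcludedMiddle 0ℓ → ∀ {n} →
                            (¬ ModWalk F n) ⇔ (¬ Cycle F n × NoStrictlyAscendingChain F)
  ¬modWalk⇔¬cycle×noChain lem = mk⇔
    (λ ¬mw → ¬mw ∘ cycle⇒modWalk , ¬mw ∘ chain⇒modWalk)
    (λ (¬cycle , ¬chain) → [ ¬cycle , ¬chain ]′ ∘ modWalk⇒cycle⊎chain lem)

  validℂ⇔¬modWalk : ExcludedMiddle 0ℓ → ∀ {n} → Valid F (ℂ n) ⇔ (¬ ModWalk F n)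
  validℂ⇔¬modWalk lem = mk⇔
    (λ valid mw → modWalk⇒¬validℂ mw valid)
    (λ ¬mw V x body → ¬mw (counterexample⇒modWalk lem (¬ℂ⇒counterexample lem λ satℂ → satℂ body)))

theorem4p2 : ExcludedMiddle 0ℓ → (F : Frame) → Transitive F → (n : ℕ)
    → (ValidC F n ⇔ (CircumferenceAtMost F n × NoStrictlyAscendingChain F))
    × (Finite F → (ValidC F n ⇔ CircumferenceAtMost F n))
theorem4p2 lem F tr n = characterisation , λ finite → mk⇔
  (proj₁ ∘ to characterisation) (λ circ → from characterisation (circ , finite⇒noChain {F} tr finite))
  where
  characterisation : ValidC F n ⇔ (CircumferenceAtMost F n × NoStrictlyAscendingChain F)
  characterisation =
    ⇔.trans (validInstances⇔valid (ℂ n)) (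
    ⇔.trans (validℂ⇔¬modWalk {F} tr lem) (
    ⇔.trans (¬modWalk⇔¬cycle×noChain {F} tr lem)
            (⇔.sym (circumference≤⇔¬cycle {F} tr) ×-⇔ ⇔.refl)))
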